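{- Let $p\neq q$ be primes, $S=\{p,q\}$, and let $(a,b,c,d)$ be an $S$-Diophantine quadruple. Write $ab+1=p^{\alpha_1}q^{\beta_1}$, $ac+1=p^{\alpha_2}q^{\beta_2}$, $ad+1=p^{\alpha_3}q^{\beta_3}$, $bc+1=p^{\alpha_4}q^{\beta_4}$, $bd+1=p^{\alpha_5}q^{\beta_5}$, $cd+1=p^{\alpha_6}q^{\beta_6}$ with nonnegative integers $\alpha_i,\beta_i$. Then in each of the quadruples $(\alpha_2,\alpha_3,\alpha_4,\alpha_5)$, $(\alpha_1,\alpha_2,\alpha_5,\alpha_6)$ and $(\alpha_1,\alpha_3,\alpha_4,\alpha_6)$ the two smallest entries are equal (i.e. the minimum is attained by at least two entries), and the same holds for the quadruples $(\beta_2,\beta_3,\beta_4,\beta_5)$, $(\beta_1,\beta_2,\beta_5,\beta_6)$ and $(\beta_1,\beta_3,\beta_4,\beta_6)$.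
   Context: For a finite set $S$ of primes, a positive integer is an $S$-unit if all its prime factors lie in $S$. A quadruple $(a,b,c,d)$ of positive, pairwise distinct integers is an $S$-Diophantine quadruple if the product of any two distinct entries plus $1$ is an $S$-unit. -}

module Defs where

open import Data.Nat using (ℕ; _⊓_)
open import Data.Sum using (_⊎_)
open import Relation.Binary.PropositionalEquality using (_≡_)

MinTwice : ℕ → ℕ → ℕ → ℕ → Set
MinTwice w x y z =
  let m = w ⊓ x ⊓ y ⊓ z in
  (w ≡ m × x ≡ m) ⊎ (w ≡ m × y ≡ m) ⊎ (w ≡ m × z ≡ m) ⊎
  (x ≡ m × y ≡ m) ⊎ (x ≡ m × z ≡ m) ⊎ (y ≡ m × z ≡ m)
  where open import Data.Product using (_×_)

{-# OPTIONS --safe #-}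
module Submission where

-- For any naturals x₀, x₁, y₀, y₁, every common divisor of three of the four
-- numbers xᵢyⱼ + 1 also divides the fourth: by
--   (x₀y₁ + 1)(x₁y₀ + 1) + (x₁y₁ + 1) = (x₀y₁ + 1) + (x₁y₀ + 1) + x₁y₁(x₀y₀ + 1)
-- it divides x₁y₁(x₀y₀ + 1), and it is coprime to x₁y₁ because it divides x₁y₁ + 1.
-- So if the p-exponent e of one of the four numbers were strictly smaller than the
-- other three, p^(e+1) would divide all four; hence the minimum of the four
-- exponents is attained twice. The squares {a,b}×{c,d}, {a,d}×{b,c} and
-- {a,c}×{b,d} of a quadruple give the three exponent quadruples of the theorem.

open import Defs
open import Data.Nat using (ℕ; suc; _+_; _*_; _^_; _≤_; _<_; _⊓_; NonZero)
open import Data.Nat.Properties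
open import Data.Nat.Divisibility
open import Data.Nat.Coprimality using (Coprime; coprime-divisor)
open import Data.Nat.Primality
open import Data.Nat.Solver using (module +-*-Solver)
open import Data.Product using (_×_; _,_)
open import Data.Sum using (_⊎_; inj₁; inj₂)
open import Data.Empty using (⊥-elim)
open import Relation.Nullary using (¬_)
open import Function using (_∘_; case_of_)
open import Relation.Binary.PropositionalEquality
open +-*-Solver using (solve; _:=_; _:+_; _:*_; con)

products+1-identity : ∀ x₀ x₁ y₀ y₁ →
  (x₀ * y₁ + 1) * (x₁ * y₀ + 1) + (x₁ * y₁ + 1)
    ≡ (x₀ * y₁ + 1) + (x₁ * y₀ + 1) + x₁ * y₁ * (x₀ * y₀ + 1)
products+1-identity = solve 4 (λ x₀ x₁ y₀ y₁ →
  (x₀ :* y₁ :+ con 1) :* (x₁ :* y₀ :+ con 1) :+ (x₁ :* y₁ :+ con 1)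
    := (x₀ :* y₁ :+ con 1) :+ (x₁ :* y₀ :+ con 1) :+ x₁ :* y₁ :* (x₀ :* y₀ :+ con 1)) refl

∣-fourth-product+1 : ∀ {N} x₀ x₁ y₀ y₁ →
  N ∣ x₀ * y₁ + 1 → N ∣ x₁ * y₀ + 1 → N ∣ x₁ * y₁ + 1 → N ∣ x₀ * y₀ + 1
∣-fourth-product+1 {N} x₀ x₁ y₀ y₁ ∣x₀y₁+1 ∣x₁y₀+1 ∣x₁y₁+1 =
  coprime-divisor coprime ∣x₁y₁[x₀y₀+1]
  where
  ∣x₁y₁[x₀y₀+1] : N ∣ x₁ * y₁ * (x₀ * y₀ + 1)
  ∣x₁y₁[x₀y₀+1] = ∣m+n∣m⇒∣n
    (subst (N ∣_) (products+1-identity x₀ x₁ y₀ y₁)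
      (∣m∣n⇒∣m+n (∣m⇒∣m*n _ ∣x₀y₁+1) ∣x₁y₁+1))
    (∣m∣n⇒∣m+n ∣x₀y₁+1 ∣x₁y₀+1)
  coprime : Coprime N (x₁ * y₁)
  coprime (d∣N , d∣x₁y₁) = ∣1⇒≡1 (∣m+n∣m⇒∣n (∣-trans d∣N ∣x₁y₁+1) d∣x₁y₁)

≤⇒^∣^ : ∀ P {m n} → m ≤ n → P ^ m ∣ P ^ n
≤⇒^∣^ P {m} m≤n with m≤n⇒∃[o]m+o≡n m≤n
... | o , refl = divides (P ^ o) (trans (^-distribˡ-+-* P m o) (*-comm (P ^ m) (P ^ o)))

prime∣^⇒∣ : ∀ {P Q} → Prime P → ∀ f → P ∣ Q ^ f → P ∣ Q
prime∣^⇒∣ pP 0 P∣1 = ⊥-elim (¬prime[1] (subst Prime (∣1⇒≡1 P∣1) pP))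
prime∣^⇒∣ {Q = Q} pP (suc f) P∣Q^[1+f] with euclidsLemma Q (Q ^ f) pP P∣Q^[1+f]
... | inj₁ P∣Q   = P∣Q
... | inj₂ P∣Q^f = prime∣^⇒∣ pP f P∣Q^f

prime∤prime : ∀ {P Q} → Prime P → Prime Q → P ≢ Q → P ∤ Q
prime∤prime pP pQ P≢Q P∣Q with prime⇒irreducible pQ P∣Q
... | inj₁ P≡1 = ¬prime[1] (subst Prime P≡1 pP)
... | inj₂ P≡Q = P≢Q P≡Q

record ExactPower (P e n : ℕ) : Set where
  constructor _,_
  field
    power∣      : P ^ e ∣ n
    next-power∤ : P ^ suc e ∤ n

^*-exactPower : ∀ {P m} e .{{_ : NonZero P}} → P ∤ m → ExactPower P e (P ^ e * m)
^*-exactPower {P} {m} e P∤m = m∣m*n m , P^[1+e]∤P^e*m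
  where
  P^[1+e]∤P^e*m : P ^ suc e ∤ P ^ e * m
  P^[1+e]∤P^e*m P^[1+e]∣P^e*m = P∤m (*-cancelˡ-∣ (P ^ e) {{m^n≢0 P e}}
    (subst (_∣ P ^ e * m) (*-comm P (P ^ e)) P^[1+e]∣P^e*m))

distinct-primes-exactPower : ∀ {P Q} → Prime P → Prime Q → P ≢ Q →
  ∀ e f → ExactPower P e (P ^ e * Q ^ f)
distinct-primes-exactPower pP pQ P≢Q e f =
  ^*-exactPower e {{prime⇒nonZero pP}} (prime∤prime pP pQ P≢Q ∘ prime∣^⇒∣ pP f)

NoStrictMin : ℕ → ℕ → ℕ → ℕ → Set
NoStrictMin w x y z = ¬ (w < x × w < y × w < z)

another-attains : ∀ {m w x y z} → w ≡ m → m ≤ x → m ≤ y → m ≤ z →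
  NoStrictMin w x y z → x ≡ m ⊎ y ≡ m ⊎ z ≡ m
another-attains refl m≤x m≤y m≤z no-strict-min
  with m≤n⇒m<n∨m≡n m≤x | m≤n⇒m<n∨m≡n m≤y | m≤n⇒m<n∨m≡n m≤z
... | inj₂ m≡x | _        | _        = inj₁ (sym m≡x)
... | inj₁ _   | inj₂ m≡y | _        = inj₂ (inj₁ (sym m≡y))
... | inj₁ _   | inj₁ _   | inj₂ m≡z = inj₂ (inj₂ (sym m≡z))
... | inj₁ m<x | inj₁ m<y | inj₁ m<z = ⊥-elim (no-strict-min (m<x , m<y , m<z))

⊓₄-sel : ∀ w x y z → let m = w ⊓ x ⊓ y ⊓ z in w ≡ m ⊎ x ≡ m ⊎ y ≡ m ⊎ z ≡ m
⊓₄-sel w x y z with ⊓-sel (w ⊓ x ⊓ y) z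
... | inj₂ m≡z = inj₂ (inj₂ (inj₂ (sym m≡z)))
... | inj₁ m≡wxy with ⊓-sel (w ⊓ x) y
...   | inj₂ wxy≡y = inj₂ (inj₂ (inj₁ (sym (trans m≡wxy wxy≡y))))
...   | inj₁ wxy≡wx with ⊓-sel w x
...     | inj₁ wx≡w = inj₁ (sym (trans m≡wxy (trans wxy≡wx wx≡w)))
...     | inj₂ wx≡x = inj₂ (inj₁ (sym (trans m≡wxy (trans wxy≡wx wx≡x))))

-- The hypotheses are oriented as the symmetries x₀ ↔ x₁, y₀ ↔ y₁ of the square xᵢyⱼ + 1 permute them.
no-strict-min⇒min-twice : ∀ {w x y z} →
  NoStrictMin w x y z → NoStrictMin x w z y → NoStrictMin y z w x → NoStrictMin z y x w →
  MinTwice w x y z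
no-strict-min⇒min-twice {w} {x} {y} {z} nw nx ny nz = case ⊓₄-sel w x y z of λ where
    (inj₁ w≡m) → case another-attains w≡m m≤x m≤y m≤z nw of λ where
      (inj₁ x≡m)        → inj₁ (w≡m , x≡m)
      (inj₂ (inj₁ y≡m)) → inj₂ (inj₁ (w≡m , y≡m))
      (inj₂ (inj₂ z≡m)) → inj₂ (inj₂ (inj₁ (w≡m , z≡m)))
    (inj₂ (inj₁ x≡m)) → case another-attains x≡m m≤w m≤z m≤y nx of λ where
      (inj₁ w≡m)        → inj₁ (w≡m , x≡m)
      (inj₂ (inj₁ z≡m)) → inj₂ (inj₂ (inj₂ (inj₂ (inj₁ (x≡m , z≡m)))))
      (inj₂ (inj₂ y≡m)) → inj₂ (inj₂ (inj₂ (inj₁ (x≡m , y≡m))))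
    (inj₂ (inj₂ (inj₁ y≡m))) → case another-attains y≡m m≤z m≤w m≤x ny of λ where
      (inj₁ z≡m)        → inj₂ (inj₂ (inj₂ (inj₂ (inj₂ (y≡m , z≡m)))))
      (inj₂ (inj₁ w≡m)) → inj₂ (inj₁ (w≡m , y≡m))
      (inj₂ (inj₂ x≡m)) → inj₂ (inj₂ (inj₂ (inj₁ (x≡m , y≡m))))
    (inj₂ (inj₂ (inj₂ z≡m))) → case another-attains z≡m m≤y m≤x m≤w nz of λ where
      (inj₁ y≡m)        → inj₂ (inj₂ (inj₂ (inj₂ (inj₂ (y≡m , z≡m)))))
      (inj₂ (inj₁ x≡m)) → inj₂ (inj₂ (inj₂ (inj₂ (inj₁ (x≡m , z≡m)))))
      (inj₂ (inj₂ w≡m)) → inj₂ (inj₂ (inj₁ (w≡m , z≡m)))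
  where
  m : ℕ
  m = w ⊓ x ⊓ y ⊓ z
  m≤w⊓x⊓y : m ≤ w ⊓ x ⊓ y
  m≤w⊓x⊓y = m⊓n≤m (w ⊓ x ⊓ y) z
  m≤w : m ≤ w
  m≤w = ≤-trans m≤w⊓x⊓y (≤-trans (m⊓n≤m (w ⊓ x) y) (m⊓n≤m w x))
  m≤x : m ≤ x
  m≤x = ≤-trans m≤w⊓x⊓y (≤-trans (m⊓n≤m (w ⊓ x) y) (m⊓n≤n w x))
  m≤y : m ≤ y
  m≤y = ≤-trans m≤w⊓x⊓y (m⊓n≤n (w ⊓ x) y)
  m≤z : m ≤ z
  m≤z = m⊓n≤n (w ⊓ x ⊓ y) z

exactPower-corner-not-strict-min : ∀ {P e₀₀ e₀₁ e₁₀ e₁₁} x₀ x₁ y₀ y₁ →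
  ExactPower P e₀₀ (x₀ * y₀ + 1) → ExactPower P e₀₁ (x₀ * y₁ + 1) →
  ExactPower P e₁₀ (x₁ * y₀ + 1) → ExactPower P e₁₁ (x₁ * y₁ + 1) →
  NoStrictMin e₀₀ e₀₁ e₁₀ e₁₁
exactPower-corner-not-strict-min {P} x₀ x₁ y₀ y₁
  (_ , P^[1+e₀₀]∤) (P^e₀₁∣ , _) (P^e₁₀∣ , _) (P^e₁₁∣ , _) (e₀₀<e₀₁ , e₀₀<e₁₀ , e₀₀<e₁₁) =
  P^[1+e₀₀]∤ (∣-fourth-product+1 x₀ x₁ y₀ y₁
    (∣-trans (≤⇒^∣^ P e₀₀<e₀₁) P^e₀₁∣)
    (∣-trans (≤⇒^∣^ P e₀₀<e₁₀) P^e₁₀∣)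
    (∣-trans (≤⇒^∣^ P e₀₀<e₁₁) P^e₁₁∣))

exactPower-square-min-twice : ∀ {P e₀₀ e₀₁ e₁₀ e₁₁} x₀ x₁ y₀ y₁ →
  ExactPower P e₀₀ (x₀ * y₀ + 1) → ExactPower P e₀₁ (x₀ * y₁ + 1) →
  ExactPower P e₁₀ (x₁ * y₀ + 1) → ExactPower P e₁₁ (x₁ * y₁ + 1) →
  MinTwice e₀₀ e₀₁ e₁₀ e₁₁
exactPower-square-min-twice x₀ x₁ y₀ y₁ E₀₀ E₀₁ E₁₀ E₁₁ = no-strict-min⇒min-twice
  (exactPower-corner-not-strict-min x₀ x₁ y₀ y₁ E₀₀ E₀₁ E₁₀ E₁₁)
  (exactPower-corner-not-strict-min x₀ x₁ y₁ y₀ E₀₁ E₀₀ E₁₁ E₁₀)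
  (exactPower-corner-not-strict-min x₁ x₀ y₀ y₁ E₁₀ E₁₁ E₀₀ E₀₁)
  (exactPower-corner-not-strict-min x₁ x₀ y₁ y₀ E₁₁ E₁₀ E₀₁ E₀₀)

exactPower-quadruple-min-twice : ∀ {P e₁ e₂ e₃ e₄ e₅ e₆} a b c d →
  ExactPower P e₁ (a * b + 1) → ExactPower P e₂ (a * c + 1) → ExactPower P e₃ (a * d + 1) →
  ExactPower P e₄ (b * c + 1) → ExactPower P e₅ (b * d + 1) → ExactPower P e₆ (c * d + 1) →
  MinTwice e₂ e₃ e₄ e₅ × MinTwice e₁ e₂ e₅ e₆ × MinTwice e₁ e₃ e₄ e₆
exactPower-quadruple-min-twice {P} a b c d E₁ E₂ E₃ E₄ E₅ E₆ =
    exactPower-square-min-twice a b c d E₂ E₃ E₄ E₅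
  , exactPower-square-min-twice a d b c E₁ E₂ (swap b d E₅) (swap c d E₆)
  , exactPower-square-min-twice a c b d E₁ E₃ (swap b c E₄) E₆
  where
  swap : ∀ {e} x y → ExactPower P e (x * y + 1) → ExactPower P e (y * x + 1)
  swap {e} x y = subst (λ n → ExactPower P e (n + 1)) (*-comm x y)

lemma1 : (p q : ℕ) → Prime p → Prime q → p ≢ q →
         (a b c d : ℕ) → a ≢ 0 → b ≢ 0 → c ≢ 0 → d ≢ 0 →
         a ≢ b → a ≢ c → a ≢ d → b ≢ c → b ≢ d → c ≢ d →
         (α₁ α₂ α₃ α₄ α₅ α₆ β₁ β₂ β₃ β₄ β₅ β₆ : ℕ) →
         a * b + 1 ≡ p ^ α₁ * q ^ β₁ →
         a * c + 1 ≡ p ^ α₂ * q ^ β₂ →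
         a * d + 1 ≡ p ^ α₃ * q ^ β₃ →
         b * c + 1 ≡ p ^ α₄ * q ^ β₄ →
         b * d + 1 ≡ p ^ α₅ * q ^ β₅ →
         c * d + 1 ≡ p ^ α₆ * q ^ β₆ →
         (MinTwice α₂ α₃ α₄ α₅ × MinTwice α₁ α₂ α₅ α₆ × MinTwice α₁ α₃ α₄ α₆) ×
         (MinTwice β₂ β₃ β₄ β₅ × MinTwice β₁ β₂ β₅ β₆ × MinTwice β₁ β₃ β₄ β₆)
lemma1 p q p-prime q-prime p≢q a b c d _ _ _ _ _ _ _ _ _ _
  α₁ α₂ α₃ α₄ α₅ α₆ β₁ β₂ β₃ β₄ β₅ β₆ ab ac ad bc bd cd =
    exactPower-quadruple-min-twice a b c d
      (p-exact α₁ β₁ ab) (p-exact α₂ β₂ ac) (p-exact α₃ β₃ ad)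
      (p-exact α₄ β₄ bc) (p-exact α₅ β₅ bd) (p-exact α₆ β₆ cd)
  , exactPower-quadruple-min-twice a b c d
      (q-exact α₁ β₁ ab) (q-exact α₂ β₂ ac) (q-exact α₃ β₃ ad)
      (q-exact α₄ β₄ bc) (q-exact α₅ β₅ bd) (q-exact α₆ β₆ cd)
  where
  p-exact : ∀ {n} e f → n ≡ p ^ e * q ^ f → ExactPower p e n
  p-exact e f refl = distinct-primes-exactPower p-prime q-prime p≢q e f
  q-exact : ∀ {n} e f → n ≡ p ^ e * q ^ f → ExactPower q f n
  q-exact e f refl = subst (ExactPower q f) (*-comm (q ^ f) (p ^ e))
    (distinct-primes-exactPower q-prime p-prime (p≢q ∘ sym) f e)
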